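{- Let $E$ be a low-defect expression and $f$ the corresponding low-defect polynomial. Then every term of $f$ other than the leading term (the term containing all variables) omits at least one variable that is minimal in the nesting ordering of $E$.
   Context: Low-defect expressions: (a) every positive integer constant is one; (b) the product of two low-defect expressions with disjoint variable sets is one; (c) if $E$ is one, $c$ a positive integer and $x$ a variable not in $E$, then $E\cdot x+c$ is one. Evaluating $E$ gives its low-defect polynomial $f$ (multilinear, with a nonzero term containing all variables). Each variable occurs exactly once in $E$. Nesting ordering: for variables $x,y$ of $E$, $x\preceq y$ iff $x$ appears in the smallest low-defect subexpression of $E$ containing $y$ (this subexpression has the form $E'\cdot y+c$); this is a partial order. -}

module Defs where

open import Data.Nat using (ℕ; zero; suc; _+_; _*_; _≟_)
open import Data.Nat.Properties using (≤-decTotalOrder)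
open import Data.List using (List; []; _∷_; _++_; map; concatMap; sum)
open import Data.List.Properties using (≡-dec)
open import Data.List.Membership.Propositional using (_∈_; _∉_)
open import Data.List.Relation.Unary.All using (All)
open import Data.Product using (_×_; _,_; proj₁; proj₂)
open import Data.Sum using (_⊎_)
open import Data.Empty using (⊥)
open import Data.Unit using (⊤)
open import Relation.Nullary using (yes; no)
open import Relation.Binary.PropositionalEquality using (_≡_)
open import Data.List.Sort.MergeSort ≤-decTotalOrder using (mergeSort)
open import Data.List.Sort.Base using (SortingAlgorithm)

Var : Set
Var = ℕ

-- Raw syntax of expressions:
--   const c      : the constant c
--   mul A B      : A · B
--   lin A x c    : A · x + c
data Expr : Set where
  const : ℕ → Expr
  mul   : Expr → Expr → Expr
  lin   : Expr → Var → ℕ → Expr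

vars : Expr → List Var
vars (const c)   = []
vars (mul A B)   = vars A ++ vars B
vars (lin A x c) = vars A ++ (x ∷ [])

Disjoint : List Var → List Var → Set
Disjoint xs ys = ∀ {v} → v ∈ xs → v ∈ ys → ⊥

data LowDefect : Expr → Set where
  ld-const : ∀ c → LowDefect (const (suc c))
  ld-mul   : ∀ {A B} → LowDefect A → LowDefect B →
             Disjoint (vars A) (vars B) → LowDefect (mul A B)
  ld-lin   : ∀ {A} x c → LowDefect A → x ∉ vars A →
             LowDefect (lin A x (suc c))

-- Polynomials with natural-number coefficients, as formal sums of terms.
-- A term is (coefficient , monomial), the monomial being the list of its
-- variable factors (with multiplicity, order irrelevant).

Monomial : Set
Monomial = List Var

Poly : Set
Poly = List (ℕ × Monomial)

polyConst : ℕ → Poly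
polyConst c = (c , []) ∷ []

polyVar : Var → Poly
polyVar x = (1 , x ∷ []) ∷ []

_⊕_ : Poly → Poly → Poly
p ⊕ q = p ++ q

_⊗_ : Poly → Poly → Poly
p ⊗ q = concatMap (λ t → map (λ s → (proj₁ t * proj₁ s , proj₂ t ++ proj₂ s)) q) p

poly : Expr → Poly
poly (const c)   = polyConst c
poly (mul A B)   = poly A ⊗ poly B
poly (lin A x c) = (poly A ⊗ polyVar x) ⊕ polyConst c

sortM : Monomial → Monomial
sortM = SortingAlgorithm.sort mergeSort

coeff : Poly → Monomial → ℕ
coeff [] m = 0
coeff ((c , m') ∷ p) m with ≡-dec _≟_ (sortM m') (sortM m)
... | yes _ = c + coeff p m
... | no  _ = coeff p m

IsTerm : Poly → Monomial → Set
IsTerm p m = coeff p m ≡ 0 → ⊥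

-- Nesting ordering:  Nest E x y  means  x ⪯ y, i.e. x appears in the
-- smallest low-defect subexpression of E containing y, which is the
-- subexpression of the form E' · y + c.
Nest : Expr → Var → Var → Set
Nest (const c)   x y = ⊥
Nest (mul A B)   x y = Nest A x y ⊎ Nest B x y
Nest (lin A z c) x y = (z ≡ y × (x ∈ vars (lin A z c))) ⊎ Nest A x y

Minimal : Expr → Var → Set
Minimal E x = x ∈ vars E × (∀ y → y ∈ vars E → Nest E y x → y ≡ x)

-- Call a monomial of E admissible if its variables are among those of E and
-- it either contains every variable of E or omits some minimal variable of E.
-- By induction on E, every monomial of the (uncollected) polynomial of E is
-- admissible: in E · x + c the constant omits a minimal variable, which always
-- exists, and in a product of expressions with disjoint variables, a minimal
-- variable omitted by one factor cannot be supplied by the other. A term of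
-- the collected polynomial comes from such a monomial up to reordering.
module Submission where

open import Defs
open import Data.Nat using (ℕ; suc; _*_; _≟_)
open import Data.Nat.Properties using (≤-decTotalOrder)
open import Data.Product using (∃; ∃₂; _×_; _,_; proj₁; proj₂)
open import Data.Sum using (_⊎_; inj₁; inj₂; [_,_]′)
open import Data.Empty using (⊥-elim)
open import Function using (_∘_)
open import Data.List using ([]; _∷_; _++_; map)
open import Data.List.Properties using (≡-dec)
open import Data.List.Relation.Unary.Any using (here; there)
open import Data.List.Relation.Unary.Any.Properties using (singleton⁻)
open import Data.List.Membership.Propositional using (_∈_; _∉_; find)
open import Data.List.Membership.Propositional.Properties using (∈-++⁺ˡ; ∈-++⁺ʳ; ∈-++⁻; ∈-map⁻; ∈-concatMap⁻)
open import Data.List.Relation.Binary.Subset.Propositional using (_⊆_)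
import Data.List.Relation.Binary.Subset.Propositional.Properties as ⊆
open import Data.List.Relation.Binary.Permutation.Propositional using (_↭_; ↭-refl; ↭-sym; ↭-trans; ↭⇒↭ₛ)
open import Data.List.Relation.Binary.Permutation.Propositional.Properties using (∈-resp-↭)
import Data.List.Relation.Binary.Permutation.Propositional.Properties as ↭
open import Data.List.Relation.Unary.Sorted.TotalOrder.Properties using (↗↭↗⇒≋)
open import Data.List.Relation.Binary.Pointwise using (Pointwise-≡⇒≡)
open import Data.List.Sort.MergeSort ≤-decTotalOrder using (mergeSort)
open import Data.List.Sort.Base using (module SortingAlgorithm)
open import Relation.Binary.Bundles using (DecTotalOrder)
open import Relation.Binary.PropositionalEquality using (_≡_; refl; sym; trans; subst)
open import Relation.Nullary using (¬_; yes; no)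

open SortingAlgorithm mergeSort using (sort-↭; sort-↗)

sortM-resp-↭ : ∀ {xs ys} → xs ↭ ys → sortM xs ≡ sortM ys
sortM-resp-↭ {xs} {ys} xs↭ys = Pointwise-≡⇒≡
  (↗↭↗⇒≋ (DecTotalOrder.totalOrder ≤-decTotalOrder) (sort-↗ xs) (sort-↗ ys)
    (↭⇒↭ₛ (↭-trans (sort-↭ xs) (↭-trans xs↭ys (↭-sym (sort-↭ ys))))))

∈-resp-sortM : ∀ {v xs ys} → sortM xs ≡ sortM ys → v ∈ ys → v ∈ xs
∈-resp-sortM {xs = xs} {ys} eq v∈ys =
  ∈-resp-↭ (sort-↭ xs) (subst (_ ∈_) (sym eq) (∈-resp-↭ (↭-sym (sort-↭ ys)) v∈ys))

isTerm⇒∈ : ∀ {p m} → IsTerm p m → ∃ λ t → t ∈ p × sortM (proj₂ t) ≡ sortM m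
isTerm⇒∈ {[]} term = ⊥-elim (term refl)
isTerm⇒∈ {(c , m′) ∷ p} {m} term with ≡-dec _≟_ (sortM m′) (sortM m)
... | yes eq = _ , here refl , eq
... | no _ with t , t∈p , eq ← isTerm⇒∈ {p} term = t , there t∈p , eq

_·_ : ℕ × Monomial → ℕ × Monomial → ℕ × Monomial
u · s = proj₁ u * proj₁ s , proj₂ u ++ proj₂ s

∈-⊗⁻ : ∀ {t p q} → t ∈ p ⊗ q →
  ∃₂ λ u s → u ∈ p × s ∈ q × t ≡ u · s
∈-⊗⁻ {p = p} {q} t∈ with u , u∈p , t∈us ← find (∈-concatMap⁻ (λ u → map (u ·_) q) {p} t∈)
  with s , s∈q , refl ← ∈-map⁻ (u ·_) t∈us = u , s , u∈p , s∈q , refl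

nest-∈ˡ : ∀ E {y x} → Nest E y x → y ∈ vars E
nest-∈ˡ (mul A B)   (inj₁ y⪯x)      = ∈-++⁺ˡ (nest-∈ˡ A y⪯x)
nest-∈ˡ (mul A B)   (inj₂ y⪯x)      = ∈-++⁺ʳ (vars A) (nest-∈ˡ B y⪯x)
nest-∈ˡ (lin A z c) (inj₁ (_ , y∈)) = y∈
nest-∈ˡ (lin A z c) (inj₂ y⪯x)      = ∈-++⁺ˡ (nest-∈ˡ A y⪯x)

nest-∈ʳ : ∀ E {y x} → Nest E y x → x ∈ vars E
nest-∈ʳ (mul A B)   (inj₁ y⪯x)     = ∈-++⁺ˡ (nest-∈ʳ A y⪯x)
nest-∈ʳ (mul A B)   (inj₂ y⪯x)     = ∈-++⁺ʳ (vars A) (nest-∈ʳ B y⪯x)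
nest-∈ʳ (lin A z c) (inj₁ (refl , _)) = ∈-++⁺ʳ (vars A) (here refl)
nest-∈ʳ (lin A z c) (inj₂ y⪯x)     = ∈-++⁺ˡ (nest-∈ʳ A y⪯x)

minimal-mulˡ : ∀ {A B x} → Disjoint (vars A) (vars B) → Minimal A x → Minimal (mul A B) x
minimal-mulˡ {A} {B} disj (x∈A , least) = ∈-++⁺ˡ x∈A , λ
  { y _ (inj₁ y⪯x) → least y (nest-∈ˡ A y⪯x) y⪯x
  ; y _ (inj₂ y⪯x) → ⊥-elim (disj x∈A (nest-∈ʳ B y⪯x)) }

minimal-mulʳ : ∀ {A B x} → Disjoint (vars A) (vars B) → Minimal B x → Minimal (mul A B) x
minimal-mulʳ {A} {B} disj (x∈B , least) = ∈-++⁺ʳ (vars A) x∈B , λ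
  { y _ (inj₁ y⪯x) → ⊥-elim (disj (nest-∈ʳ A y⪯x) x∈B)
  ; y _ (inj₂ y⪯x) → least y (nest-∈ˡ B y⪯x) y⪯x }

-- The constant c of lin A z c occurs neither in vars nor in Nest, so it cannot
-- be inferred from a Minimal or Admissible type and is passed explicitly below.
minimal-lin : ∀ {A z c x} → z ∉ vars A → Minimal A x → Minimal (lin A z c) x
minimal-lin {A} z∉A (x∈A , least) = ∈-++⁺ˡ x∈A , λ
  { y _ (inj₁ (refl , _)) → ⊥-elim (z∉A x∈A)
  ; y _ (inj₂ y⪯x)        → least y (nest-∈ˡ A y⪯x) y⪯x }

minimal-lin-var : ∀ {A z c} → vars A ≡ [] → Minimal (lin A z c) z
minimal-lin-var {A} {z} noVars = ∈-++⁺ʳ (vars A) (here refl) , λ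
  { y _ (inj₁ (_ , y∈)) → singleton⁻ (subst (λ vs → y ∈ vs ++ z ∷ []) noVars y∈)
  ; y _ (inj₂ y⪯z)      → ⊥-elim (∉[] (subst (z ∈_) noVars (nest-∈ʳ A y⪯z))) }
  where
  ∉[] : ∀ {v} → v ∉ []
  ∉[] ()

novars⊎minimal : ∀ {E} → LowDefect E → vars E ≡ [] ⊎ ∃ (Minimal E)

minimal-lin-exists : ∀ {A z c} → LowDefect A → z ∉ vars A → ∃ (Minimal (lin A z c))
minimal-lin-exists {c = c} ldA z∉A with novars⊎minimal ldA
... | inj₁ noVars    = _ , minimal-lin-var {c = c} noVars
... | inj₂ (x , min) = x , minimal-lin {c = c} z∉A min

novars⊎minimal (ld-const c) = inj₁ refl
novars⊎minimal {mul A B} (ld-mul ldA ldB disj) with novars⊎minimal ldA | novars⊎minimal ldB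
... | inj₂ (x , min) | _              = inj₂ (x , minimal-mulˡ {A} {B} disj min)
... | inj₁ _         | inj₂ (x , min) = inj₂ (x , minimal-mulʳ {A} {B} disj min)
... | inj₁ noA       | inj₁ noB rewrite noA | noB = inj₁ refl
novars⊎minimal (ld-lin z c ldA z∉A) = inj₂ (minimal-lin-exists {c = suc c} ldA z∉A)

Omits : Expr → Monomial → Set
Omits E m = ∃ λ x → Minimal E x × x ∉ m

Admissible : Expr → Monomial → Set
Admissible E m = m ⊆ vars E × (m ↭ vars E ⊎ Omits E m)

omits-mulˡ : ∀ {A B t s} → Disjoint (vars A) (vars B) → s ⊆ vars B →
  Omits A t → Omits (mul A B) (t ++ s)
omits-mulˡ {t = t} disj s⊆B (x , min , x∉t) = x , minimal-mulˡ disj min , λ x∈ts →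
  [ x∉t , disj (proj₁ min) ∘ s⊆B ]′ (∈-++⁻ t x∈ts)

omits-mulʳ : ∀ {A B t s} → Disjoint (vars A) (vars B) → t ⊆ vars A →
  Omits B s → Omits (mul A B) (t ++ s)
omits-mulʳ {t = t} disj t⊆A (x , min , x∉s) = x , minimal-mulʳ disj min , λ x∈ts →
  [ (λ x∈t → disj (t⊆A x∈t) (proj₁ min)) , x∉s ]′ (∈-++⁻ t x∈ts)

omits-lin : ∀ {A z c t} → z ∉ vars A → Omits A t → Omits (lin A z c) (t ++ z ∷ [])
omits-lin {c = c} {t} z∉A (x , min , x∉t) = x , minimal-lin {c = c} z∉A min , λ x∈tz →
  [ x∉t , (λ { (here refl) → z∉A (proj₁ min) }) ]′ (∈-++⁻ t x∈tz)

admissible-mul : ∀ {A B t s} → Disjoint (vars A) (vars B) →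
  Admissible A t → Admissible B s → Admissible (mul A B) (t ++ s)
admissible-mul disj (t⊆A , t-full⊎omits) (s⊆B , s-full⊎omits) =
  ⊆.++⁺ t⊆A s⊆B , full⊎omits t-full⊎omits s-full⊎omits
  where
  full⊎omits : _ ⊎ _ → _ ⊎ _ → _ ⊎ _
  full⊎omits (inj₁ t↭A) (inj₁ s↭B) = inj₁ (↭.++⁺ t↭A s↭B)
  full⊎omits (inj₂ omA) _          = inj₂ (omits-mulˡ disj s⊆B omA)
  full⊎omits (inj₁ _)   (inj₂ omB) = inj₂ (omits-mulʳ disj t⊆A omB)

admissible-lin : ∀ {A z c t} → z ∉ vars A →
  Admissible A t → Admissible (lin A z c) (t ++ z ∷ [])
admissible-lin {z = z} {c} z∉A (t⊆A , t-full⊎omits) =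
  ⊆.++⁺ˡ (z ∷ []) t⊆A , [ inj₁ ∘ ↭.++⁺ʳ (z ∷ []) , inj₂ ∘ omits-lin {c = c} z∉A ]′ t-full⊎omits

admissible-[] : ∀ {E} → ∃ (Minimal E) → Admissible E []
admissible-[] (x , min) = (λ ()) , inj₂ (x , min , λ ())

poly-admissible : ∀ {E t} → LowDefect E → t ∈ poly E → Admissible E (proj₂ t)
poly-admissible (ld-const c) (here refl) = (λ ()) , inj₁ ↭-refl
poly-admissible {mul A B} (ld-mul ldA ldB disj) t∈
  with u , s , u∈ , s∈ , refl ← ∈-⊗⁻ {p = poly A} t∈ =
  admissible-mul {A} {B} disj (poly-admissible ldA u∈) (poly-admissible ldB s∈)
poly-admissible {lin A z _} (ld-lin z c ldA z∉A) t∈ with ∈-++⁻ (poly A ⊗ polyVar z) t∈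
... | inj₁ t∈Az with u , _ , u∈ , here refl , refl ← ∈-⊗⁻ {p = poly A} {polyVar z} t∈Az =
  admissible-lin {c = suc c} z∉A (poly-admissible ldA u∈)
... | inj₂ (here refl) = admissible-[] {lin A z (suc c)} (minimal-lin-exists {c = suc c} ldA z∉A)

corollary3p15 : (E : Expr) → LowDefect E → (m : Monomial) →
    IsTerm (poly E) m → ¬ (sortM m ≡ sortM (vars E)) →
    ∃ λ x → Minimal E x × x ∉ m
corollary3p15 E ld m term m≠E with t , t∈ , t≈m ← isTerm⇒∈ term
  with proj₂ (poly-admissible ld t∈)
... | inj₁ t↭E             = ⊥-elim (m≠E (trans (sym t≈m) (sortM-resp-↭ t↭E)))
... | inj₂ (x , min , x∉t) = x , min , x∉t ∘ ∈-resp-sortM t≈m
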